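{- Let $\mathcal{V}=\mathrm{Av}(132,312)$, partially ordered by pattern containment. For $\pi\in\mathcal{V}$ of length $n$ let $\pi^\omega=c_2c_3\cdots c_n\in\{a,b\}^{n-1}$ where $c_i=a$ if $\pi(i)>\pi(1)$ and $c_i=b$ if $\pi(i)<\pi(1)$. Then $\omega$ is a bijection from the permutations of length $n$ in $\mathcal{V}$ onto $\{a,b\}^{n-1}$ for each $n\ge1$, and the map $\xi:\mathcal{V}\to\mathcal{V}$ defined by $\pi^\xi=\big((\pi^\omega)^{\mathrm{rev}}\big)^{\omega^{ -1}}$ (apply $\omega$, reverse the word, then apply $\omega^{ -1}$) is a poset automorphism of $\mathcal{V}$.
   Context: Permutations are finite, in one-line notation; $\mathrm{Av}(132,312)$ is the set of permutations containing neither $132$ nor $312$ as a pattern. For a word $w=w_1\cdots w_m$, $w^{\mathrm{rev}}=w_m\cdots w_1$. For example $45367821^\omega=abaaabb$ and $45367821^\xi=43256718$. -}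

module Defs where

open import Data.Nat using (ℕ; zero; suc)
open import Data.Fin using (Fin; zero; suc; _<_; _<?_)
open import Data.Vec using (Vec; []; _∷_; lookup)
open import Data.Product using (Σ; _×_; ∃)
open import Relation.Nullary using (¬_; yes; no)
open import Relation.Binary.PropositionalEquality using (_≡_)
open import Function.Bundles using (_⇔_)

IsPerm : ∀ {n} → Vec (Fin n) n → Set
IsPerm {n} v = ∀ (i j : Fin n) → lookup v i ≡ lookup v j → i ≡ j

_≼_ : ∀ {k n} → Vec (Fin k) k → Vec (Fin n) n → Set
_≼_ {k} {n} σ π =
  Σ (Fin k → Fin n) λ f →
    (∀ i j → i < j → f i < f j) ×
    (∀ i j → (lookup σ i < lookup σ j) ⇔ (lookup π (f i) < lookup π (f j)))

-- The patterns 132 and 312 (0-based values).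
p132 : Vec (Fin 3) 3
p132 = zero ∷ suc (suc zero) ∷ suc zero ∷ []

p312 : Vec (Fin 3) 3
p312 = suc (suc zero) ∷ zero ∷ suc zero ∷ []

InV : ∀ {n} → Vec (Fin n) n → Set
InV π = IsPerm π × ¬ (p132 ≼ π) × ¬ (p312 ≼ π)

data AB : Set where
  a b : AB

compareWith : ∀ {n k} → Fin n → Vec (Fin n) k → Vec AB k
compareWith x [] = []
compareWith x (y ∷ ys) with x <? y
... | yes _ = a ∷ compareWith x ys
... | no  _ = b ∷ compareWith x ys

ω : ∀ {m} → Vec (Fin (suc m)) (suc m) → Vec AB m
ω (x ∷ xs) = compareWith x xs

module Submission where

-- A permutation avoids 132 and 312 exactly when every entry after the first is either larger
-- than all entries before it (letter a) or smaller than all of them (letter b); the word ω π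
-- records these letters, and the word determines the permutation because it determines the
-- relative order of any two entries: the later one is above or below the earlier one according
-- to its letter. For two such permutations, σ ≼ π therefore amounts to ω σ being a scattered
-- subword of ω π: an occurrence of σ reads off the letters of its non-initial entries by
-- comparing them with its first entry, and conversely a subword, with the first entry of π
-- prepended, gives an occurrence. Reversal preserves the subword order, so ξ preserves ≼.

open import Defs
open import Data.Nat using (ℕ; zero; suc; z≤n; s≤s; z<s; s<s; s<s⁻¹) renaming (_<_ to _<ℕ_; _≤_ to _≤ℕ_)
import Data.Nat.Properties as ℕ
open import Data.Fin
  using (Fin; zero; suc; toℕ; fromℕ; fromℕ<; inject₁; punchIn; punchOut; lift; opposite; _≤_; _<_; _<?_)
open import Data.Fin.Properties
  using ( <-cmp; <-irrefl; <-asym; <-trans; ≤∧≢⇒<; 0≢1+n; suc-injective; toℕ-injective; toℕ-inject₁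
        ; toℕ-fromℕ<; toℕ<n; any?; _≟_; injective⇒≤; punchOut-injective; punchIn-punchOut; punchIn-injective
        ; punchIn-mono-≤; opposite-prop; opposite-involutive )
open import Data.Vec using (Vec; []; _∷_; _∷ʳ_; lookup; map; reverse; tabulate)
open import Data.Vec.Properties using (lookup-map; reverse-∷; reverse-involutive; tabulate∘lookup; tabulate-cong)
open import Data.Product using (Σ; _×_; ∃; _,_; proj₁; proj₂)
open import Data.Empty using (⊥; ⊥-elim)
open import Function using (id; _∘_)
open import Function.Bundles using (_⇔_; mk⇔; Equivalence)
import Function.Properties.Equivalence as ⇔
open import Relation.Nullary using (¬_; yes; no; contradiction)
open import Relation.Binary.Definitions using (tri<; tri≈; tri>)
open import Relation.Binary.PropositionalEquality
  using (_≡_; _≢_; refl; sym; trans; cong; subst; subst₂; module ≡-Reasoning)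

open Equivalence using (to; from)

private
  variable
    A : Set
    k m n n′ : ℕ

both-true : {P Q : Set} → P → Q → P ⇔ Q
both-true p q = mk⇔ (λ _ → q) (λ _ → p)

both-false : {P Q : Set} → ¬ P → ¬ Q → P ⇔ Q
both-false ¬p ¬q = mk⇔ (⊥-elim ∘ ¬p) (⊥-elim ∘ ¬q)

Increasing : (Fin k → Fin m) → Set
Increasing f = ∀ i j → i < j → f i < f j

Beyond : AB → Fin n → Fin n → Set
Beyond a x y = x < y
Beyond b x y = y < x

Beyond⇒≢ : ∀ r {x y : Fin n} → Beyond r x y → x ≢ y
Beyond⇒≢ a x<y refl = <-irrefl refl x<y
Beyond⇒≢ b y<x refl = <-irrefl refl y<x

Beyond-map : ∀ r {f : Fin n → Fin n′} → (∀ {u v} → u < v → f u < f v) →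
             {x y : Fin n} → Beyond r x y → Beyond r (f x) (f y)
Beyond-map a mono = mono
Beyond-map b mono = mono

Beyond-between : ∀ r {x y z : Fin n} → Beyond r x z → Beyond r y z → x < z → z < y → ⊥
Beyond-between a _   y<z _   z<y = <-asym y<z z<y
Beyond-between b z<x _   x<z _   = <-asym x<z z<x

Beyond-<-agree : ∀ r {x y : Fin n} {x′ y′ : Fin n′} →
                 Beyond r x y → Beyond r x′ y′ → (x < y ⇔ x′ < y′)
Beyond-<-agree a x<y x′<y′ = both-true x<y x′<y′
Beyond-<-agree b y<x y′<x′ = both-false (<-asym y<x) (<-asym y′<x′)

Beyond->-agree : ∀ r {x y : Fin n} {x′ y′ : Fin n′} →
                 Beyond r y x → Beyond r y′ x′ → (x < y ⇔ x′ < y′)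
Beyond->-agree a y<x y′<x′ = both-false (<-asym y<x) (<-asym y′<x′)
Beyond->-agree b x<y x′<y′ = both-true x<y x′<y′

Beyond-letter : ∀ r s {x y : Fin n} {x′ y′ : Fin n′} →
                Beyond r x y → Beyond s x′ y′ → (x < y ⇔ x′ < y′) → r ≡ s
Beyond-letter a a _   _     _   = refl
Beyond-letter a b x<y y′<x′ iff = ⊥-elim (<-asym y′<x′ (to iff x<y))
Beyond-letter b a y<x x′<y′ iff = ⊥-elim (<-asym y<x (from iff x′<y′))
Beyond-letter b b _   _     _   = refl

Sides : Fin n → Vec (Fin n) k → Vec AB k → Set
Sides x xs w = ∀ j → Beyond (lookup w j) x (lookup xs j)

compareWith-sides : (x : Fin n) (xs : Vec (Fin n) k) →
                    (∀ j → x ≢ lookup xs j) → Sides x xs (compareWith x xs)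
compareWith-sides x (y ∷ ys) x∉xs zero with x <? y
... | yes x<y = x<y
... | no  x≮y = ≤∧≢⇒< (ℕ.≮⇒≥ x≮y) (x∉xs zero ∘ sym)
compareWith-sides x (y ∷ ys) x∉xs (suc j) with x <? y
... | yes _ = compareWith-sides x ys (x∉xs ∘ suc) j
... | no  _ = compareWith-sides x ys (x∉xs ∘ suc) j

sides⇒compareWith : (x : Fin n) (xs : Vec (Fin n) k) (w : Vec AB k) →
                    Sides x xs w → compareWith x xs ≡ w
sides⇒compareWith x []       []      _     = refl
sides⇒compareWith x (y ∷ ys) (a ∷ w) sides with x <? y
... | yes _   = cong (a ∷_) (sides⇒compareWith x ys w (sides ∘ suc))
... | no  x≮y = ⊥-elim (x≮y (sides zero))
sides⇒compareWith x (y ∷ ys) (b ∷ w) sides with x <? y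
... | yes x<y = ⊥-elim (<-asym x<y (sides zero))
... | no  _   = cong (b ∷_) (sides⇒compareWith x ys w (sides ∘ suc))

-- Entry j+1 of π is a left-to-right maximum if w j = a and a left-to-right minimum if w j = b.
record Records (π : Vec (Fin n) (suc m)) (w : Vec AB m) : Set where
  constructor records
  field
    beyond : ∀ i j → i < suc j → Beyond (lookup w j) (lookup π i) (lookup π (suc j))

open Records

Records⇒Beyond : {π : Vec (Fin n) (suc m)} {w : Vec AB m} → Records π w →
                 ∀ {i k j} → i < k → k ≡ suc j → Beyond (lookup w j) (lookup π i) (lookup π k)
Records⇒Beyond r i<k refl = beyond r _ _ i<k

Records⇒Sides : {x : Fin n} {xs : Vec (Fin n) m} {w : Vec AB m} → Records (x ∷ xs) w → Sides x xs w
Records⇒Sides r j = beyond r zero j z<s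

Sides⇒Records : {x : Fin n} {ρ : Vec (Fin n) (suc m)} {c : AB} {w : Vec AB m} →
                Sides x ρ (c ∷ w) → Records ρ w → Records (x ∷ ρ) (c ∷ w)
Sides⇒Records sides r = records λ
  { zero    j       _         → sides j
  ; (suc i) (suc j) (s<s i<j) → beyond r i j i<j
  }

Records⇒ω : (π : Vec (Fin (suc m)) (suc m)) {w : Vec AB m} → Records π w → ω π ≡ w
Records⇒ω (x ∷ xs) {w} r = sides⇒compareWith x xs w (Records⇒Sides r)

triple-increasing : {i₀ i₁ i₂ : Fin n} → i₀ < i₁ → i₁ < i₂ → Increasing (lookup (i₀ ∷ i₁ ∷ i₂ ∷ []))
triple-increasing i₀<i₁ i₁<i₂ zero             (suc zero)       _ = i₀<i₁
triple-increasing i₀<i₁ i₁<i₂ zero             (suc (suc zero)) _ = <-trans i₀<i₁ i₁<i₂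
triple-increasing i₀<i₁ i₁<i₂ (suc zero)       (suc (suc zero)) _ = i₁<i₂
triple-increasing i₀<i₁ i₁<i₂ (suc zero)       (suc zero)       (s<s ())
triple-increasing i₀<i₁ i₁<i₂ (suc (suc zero)) (suc zero)       (s<s ())
triple-increasing i₀<i₁ i₁<i₂ (suc (suc zero)) (suc (suc zero)) (s<s (s<s ()))

p132≼ : (π : Vec (Fin n) n) {i₀ i₁ i₂ : Fin n} → i₀ < i₁ → i₁ < i₂ →
        lookup π i₀ < lookup π i₂ → lookup π i₂ < lookup π i₁ → p132 ≼ π
p132≼ {n} π {i₀} {i₁} {i₂} i₀<i₁ i₁<i₂ v₀<v₂ v₂<v₁ =
  lookup occurrence , triple-increasing i₀<i₁ i₁<i₂ , same-order
  where
  occurrence : Vec (Fin n) 3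
  occurrence = i₀ ∷ i₁ ∷ i₂ ∷ []
  same-order : ∀ i j → (lookup p132 i < lookup p132 j) ⇔
                       (lookup π (lookup occurrence i) < lookup π (lookup occurrence j))
  same-order zero             zero             = both-false (λ ()) (<-irrefl refl)
  same-order zero             (suc zero)       = both-true z<s (<-trans v₀<v₂ v₂<v₁)
  same-order zero             (suc (suc zero)) = both-true z<s v₀<v₂
  same-order (suc zero)       zero             = both-false (λ ()) (<-asym (<-trans v₀<v₂ v₂<v₁))
  same-order (suc zero)       (suc zero)       = both-false (λ { (s<s (s<s ())) }) (<-irrefl refl)
  same-order (suc zero)       (suc (suc zero)) = both-false (λ { (s<s ()) }) (<-asym v₂<v₁)
  same-order (suc (suc zero)) zero             = both-false (λ ()) (<-asym v₀<v₂)
  same-order (suc (suc zero)) (suc zero)       = both-true (s<s z<s) v₂<v₁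
  same-order (suc (suc zero)) (suc (suc zero)) = both-false (λ { (s<s ()) }) (<-irrefl refl)

p312≼ : (π : Vec (Fin n) n) {i₀ i₁ i₂ : Fin n} → i₀ < i₁ → i₁ < i₂ →
        lookup π i₁ < lookup π i₂ → lookup π i₂ < lookup π i₀ → p312 ≼ π
p312≼ {n} π {i₀} {i₁} {i₂} i₀<i₁ i₁<i₂ v₁<v₂ v₂<v₀ =
  lookup occurrence , triple-increasing i₀<i₁ i₁<i₂ , same-order
  where
  occurrence : Vec (Fin n) 3
  occurrence = i₀ ∷ i₁ ∷ i₂ ∷ []
  same-order : ∀ i j → (lookup p312 i < lookup p312 j) ⇔
                       (lookup π (lookup occurrence i) < lookup π (lookup occurrence j))
  same-order zero             zero             = both-false (λ { (s<s (s<s ())) }) (<-irrefl refl)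
  same-order zero             (suc zero)       = both-false (λ ()) (<-asym (<-trans v₁<v₂ v₂<v₀))
  same-order zero             (suc (suc zero)) = both-false (λ { (s<s ()) }) (<-asym v₂<v₀)
  same-order (suc zero)       zero             = both-true z<s (<-trans v₁<v₂ v₂<v₀)
  same-order (suc zero)       (suc zero)       = both-false (λ ()) (<-irrefl refl)
  same-order (suc zero)       (suc (suc zero)) = both-true z<s v₁<v₂
  same-order (suc (suc zero)) zero             = both-true (s<s z<s) v₂<v₀
  same-order (suc (suc zero)) (suc zero)       = both-false (λ ()) (<-asym v₁<v₂)
  same-order (suc (suc zero)) (suc (suc zero)) = both-false (λ { (s<s ()) }) (<-irrefl refl)

InV⇒Records : (π : Vec (Fin (suc m)) (suc m)) → InV π → Records π (ω π)
InV⇒Records {m} (x ∷ xs) (perm , no132 , no312) = records beyond-left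
  where
  w : Vec AB m
  w = compareWith x xs
  sides : Sides x xs w
  sides = compareWith-sides x xs (λ j → 0≢1+n ∘ perm zero (suc j))
  beyond-left : ∀ i j → i < suc j → Beyond (lookup w j) (lookup (x ∷ xs) i) (lookup xs j)
  beyond-left zero    j _         = sides j
  beyond-left (suc q) j (s<s q<j) = later (lookup w q) (lookup w j) (sides q) (sides j)
    where
    distinct : lookup xs q ≢ lookup xs j
    distinct e = <-irrefl (suc-injective (perm (suc q) (suc j) e)) q<j
    later : ∀ r s → Beyond r x (lookup xs q) → Beyond s x (lookup xs j) →
            Beyond s (lookup xs q) (lookup xs j)
    later a b x<q j<x = <-trans j<x x<q
    later b a q<x x<j = <-trans q<x x<j
    later a a x<q x<j with <-cmp (lookup xs q) (lookup xs j)
    ... | tri< q<j′ _ _ = q<j′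
    ... | tri≈ _ q≡j _  = ⊥-elim (distinct q≡j)
    ... | tri> _ _ j<q′ = ⊥-elim (no132 (p132≼ (x ∷ xs) z<s (s<s q<j) x<j j<q′))
    later b b q<x j<x with <-cmp (lookup xs q) (lookup xs j)
    ... | tri< q<j′ _ _ = ⊥-elim (no312 (p312≼ (x ∷ xs) z<s (s<s q<j) q<j′ j<x))
    ... | tri≈ _ q≡j _  = ⊥-elim (distinct q≡j)
    ... | tri> _ _ j<q′ = j<q′

Records⇒IsPerm : {π : Vec (Fin (suc m)) (suc m)} {w : Vec AB m} → Records π w → IsPerm π
Records⇒IsPerm r i j e with <-cmp i j
... | tri≈ _ i≡j _ = i≡j
Records⇒IsPerm {w = w} r i (suc j) e | tri< i<j _ _ =
  ⊥-elim (Beyond⇒≢ (lookup w j) (beyond r i j i<j) e)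
Records⇒IsPerm {w = w} r (suc i) j e | tri> _ _ j<i =
  ⊥-elim (Beyond⇒≢ (lookup w i) (beyond r j i j<i) (sym e))

Records⇒no-between : {π : Vec (Fin n) (suc m)} {w : Vec AB m} → Records π w →
                     ∀ {i j k} → i < k → j < k → lookup π i < lookup π k → lookup π k < lookup π j → ⊥
Records⇒no-between {w = w} r {k = suc k} i<k j<k =
  Beyond-between (lookup w k) (beyond r _ k i<k) (beyond r _ k j<k)

Records⇒InV : {π : Vec (Fin (suc m)) (suc m)} {w : Vec AB m} → Records π w → InV π
Records⇒InV {π = π} r = Records⇒IsPerm r , no132 , no312
  where
  no132 : ¬ p132 ≼ π
  no132 (f , increasing , same-order) =
    Records⇒no-between r (increasing zero (suc (suc zero)) z<s) (increasing (suc zero) (suc (suc zero)) (s<s z<s))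
      (to (same-order zero (suc (suc zero))) z<s) (to (same-order (suc (suc zero)) (suc zero)) (s<s z<s))
  no312 : ¬ p312 ≼ π
  no312 (f , increasing , same-order) =
    Records⇒no-between r (increasing (suc zero) (suc (suc zero)) (s<s z<s)) (increasing zero (suc (suc zero)) z<s)
      (to (same-order (suc zero) (suc (suc zero))) z<s) (to (same-order (suc (suc zero)) zero) (s<s z<s))

injective⇒surjective : {f : Fin n → Fin n} → (∀ i j → f i ≡ f j → i ≡ j) → ∀ v → ∃ λ i → f i ≡ v
injective⇒surjective {n} {f} injective v with any? (λ i → f i ≟ v)
... | yes found = found
injective⇒surjective {suc n} {f} injective v | no missed =
  contradiction (injective⇒≤ punched-injective) ℕ.1+n≰n
  where
  avoids : ∀ i → v ≢ f i
  avoids i e = missed (i , sym e)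
  punched-injective : ∀ {i j} → punchOut (avoids i) ≡ punchOut (avoids j) → i ≡ j
  punched-injective e = injective _ _ (punchOut-injective (avoids _) (avoids _) e)

module _ {P Q : Fin n → Fin n} (P-injective : ∀ i j → P i ≡ P j → i ≡ j)
         (P⇒Q : ∀ i j → P i < P j → Q i < Q j) where

  -- Every value below P i is some P j, and then Q j < Q i.
  rank-≤ : ∀ v i → toℕ (P i) ≡ v → v ≤ℕ toℕ (Q i)
  rank-≤ zero    i _    = z≤n
  rank-≤ (suc v) i Pi≡1+v = ℕ.≤-<-trans (rank-≤ v j Pj≡v) (P⇒Q j i Pj<Pi)
    where
    v<n : v <ℕ n
    v<n = ℕ.<-trans (ℕ.n<1+n v) (subst (_<ℕ n) Pi≡1+v (toℕ<n (P i)))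
    preimage : ∃ λ j → P j ≡ fromℕ< v<n
    preimage = injective⇒surjective P-injective (fromℕ< v<n)
    j : Fin n
    j = proj₁ preimage
    Pj≡v : toℕ (P j) ≡ v
    Pj≡v = trans (cong toℕ (proj₂ preimage)) (toℕ-fromℕ< v<n)
    Pj<Pi : P j < P i
    Pj<Pi = subst₂ _<ℕ_ (sym Pj≡v) (sym Pi≡1+v) (ℕ.n<1+n v)

same-order⇒≗ : {P Q : Fin n → Fin n} → (∀ i j → P i ≡ P j → i ≡ j) → (∀ i j → Q i ≡ Q j → i ≡ j) →
               (∀ i j → P i < P j ⇔ Q i < Q j) → ∀ i → P i ≡ Q i
same-order⇒≗ P-injective Q-injective same-order i = toℕ-injective (ℕ.≤-antisym
  (rank-≤ P-injective (λ i j → to (same-order i j)) _ i refl)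
  (rank-≤ Q-injective (λ i j → from (same-order i j)) _ i refl))

lift-increasing : {g : Fin k → Fin m} → Increasing g → Increasing (lift 1 g)
lift-increasing g-increasing zero    (suc j) _         = z<s
lift-increasing g-increasing (suc i) (suc j) (s<s i<j) = s<s (g-increasing i j i<j)

lift-id : (i : Fin (suc n)) → lift 1 id i ≡ i
lift-id zero    = refl
lift-id (suc i) = refl

Records-along : {π : Vec (Fin n) (suc m)} {w : Vec AB m} → Records π w →
                {g : Fin k → Fin m} → Increasing g → {u : Vec AB k} → (∀ j → lookup u j ≡ lookup w (g j)) →
                ∀ i j → i < suc j → Beyond (lookup u j) (lookup π (lift 1 g i)) (lookup π (suc (g j)))
Records-along r {g} g-increasing letters i j i<j =
  subst (λ c → Beyond c _ _) (sym (letters j))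
    (beyond r (lift 1 g i) (g j) (lift-increasing g-increasing i (suc j) i<j))

-- The order of two entries is read off from the letter of the later one.
Records-compare : {σ : Vec (Fin n) (suc k)} {u : Vec AB k} {π : Vec (Fin n′) (suc m)} {w : Vec AB m} →
                  Records σ u → Records π w → {g : Fin k → Fin m} → Increasing g →
                  (∀ j → lookup u j ≡ lookup w (g j)) →
                  ∀ i j → (lookup σ i < lookup σ j) ⇔ (lookup π (lift 1 g i) < lookup π (lift 1 g j))
Records-compare rσ rπ g-increasing letters i j with <-cmp i j
... | tri≈ _ refl _ = both-false (<-irrefl refl) (<-irrefl refl)
Records-compare {u = u} rσ rπ g-increasing letters i (suc j) | tri< i<j _ _ =
  Beyond-<-agree (lookup u j) (beyond rσ i j i<j) (Records-along rπ g-increasing {u} letters i j i<j)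
Records-compare {u = u} rσ rπ g-increasing letters (suc i) j | tri> _ _ j<i =
  Beyond->-agree (lookup u i) (beyond rσ j i j<i) (Records-along rπ g-increasing {u} letters j i j<i)

Records-unique : {π π′ : Vec (Fin (suc m)) (suc m)} {w : Vec AB m} → Records π w → Records π′ w → π ≡ π′
Records-unique {π = π} {π′} {w} r r′ = begin
  π                       ≡⟨ tabulate∘lookup π ⟨
  tabulate (lookup π)     ≡⟨ tabulate-cong (same-order⇒≗ (Records⇒IsPerm r) (Records⇒IsPerm r′) same-order) ⟩
  tabulate (lookup π′)    ≡⟨ tabulate∘lookup π′ ⟩
  π′                      ∎
  where
  open ≡-Reasoning
  same-order : ∀ i j → (lookup π i < lookup π j) ⇔ (lookup π′ i < lookup π′ j)
  same-order i j = subst₂ (λ i′ j′ → lookup π i < lookup π j ⇔ lookup π′ i′ < lookup π′ j′)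
                     (lift-id i) (lift-id j)
                     (Records-compare {u = w} r r′ (λ _ _ → id) (λ _ → refl) i j)

punchIn-above : (x : Fin (suc n)) (z : Fin n) → x ≤ z → x < punchIn x z
punchIn-above zero    z       _         = z<s
punchIn-above (suc x) (suc z) (s≤s x≤z) = s<s (punchIn-above x z x≤z)

punchIn-below : (x : Fin (suc n)) (z : Fin n) → z < x → punchIn x z < x
punchIn-below (suc x) zero    _         = z<s
punchIn-below (suc x) (suc z) (s<s z<x) = s<s (punchIn-below x z z<x)

punchIn-mono-< : (x : Fin (suc n)) {u v : Fin n} → u < v → punchIn x u < punchIn x v
punchIn-mono-< x {u} {v} u<v =
  ≤∧≢⇒< (punchIn-mono-≤ x u v (ℕ.<⇒≤ u<v)) (λ e → <-irrefl (punchIn-injective x u v e) u<v)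

Records-map : {π : Vec (Fin n) (suc m)} {w : Vec AB m} {f : Fin n → Fin n′} →
              (∀ {u v} → u < v → f u < f v) → Records π w → Records (map f π) w
Records-map {π = π} {w} {f} f-mono r = records λ i j i<j →
  subst₂ (Beyond (lookup w j)) (sym (lookup-map i f π)) (sym (lookup-map (suc j) f π))
    (Beyond-map (lookup w j) f-mono (beyond r i j i<j))

-- The first entry of prepend c ρ is placed next to the first entry y of ρ, just below it
-- for c = a (so that y, shifted up, lies above it) and just above it for c = b.
entry : AB → Fin n → Fin (suc n)
entry a y = inject₁ y
entry b y = suc y

prepend : AB → Vec (Fin n) (suc m) → Vec (Fin (suc n)) (suc (suc m))
prepend c (y ∷ ys) = entry c y ∷ map (punchIn (entry c y)) (y ∷ ys)

entry-first : ∀ c (y : Fin n) → Beyond c (entry c y) (punchIn (entry c y) y)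
entry-first a y = punchIn-above (inject₁ y) y (ℕ.≤-reflexive (toℕ-inject₁ y))
entry-first b y = punchIn-below (suc y) y ℕ.≤-refl

entry-Beyond : ∀ c r {y z : Fin n} → Beyond r y z → Beyond r (entry c y) (punchIn (entry c y) z)
entry-Beyond a a {y} y<z =
  punchIn-above (inject₁ y) _ (ℕ.≤-trans (ℕ.≤-reflexive (toℕ-inject₁ y)) (ℕ.<⇒≤ y<z))
entry-Beyond b a     y<z = punchIn-above (suc _) _ y<z
entry-Beyond a b {y} z<y = punchIn-below (inject₁ y) _ (subst (_ <ℕ_) (sym (toℕ-inject₁ y)) z<y)
entry-Beyond b b     z<y = punchIn-below (suc _) _ (ℕ.m<n⇒m<1+n z<y)

Records-prepend : ∀ c (ρ : Vec (Fin n) (suc m)) {w : Vec AB m} → Records ρ w → Records (prepend c ρ) (c ∷ w)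
Records-prepend {n} c (y ∷ ys) {w} r = Sides⇒Records sides (Records-map (punchIn-mono-< (entry c y)) r)
  where
  x : Fin (suc n)
  x = entry c y
  sides : Sides x (map (punchIn x) (y ∷ ys)) (c ∷ w)
  sides zero    = entry-first c y
  sides (suc j) = subst (Beyond (lookup w j) x) (sym (lookup-map j (punchIn x) ys))
                    (entry-Beyond c (lookup w j) (beyond r zero j z<s))

fromWord : Vec AB m → Vec (Fin (suc m)) (suc m)
fromWord []      = zero ∷ []
fromWord (c ∷ w) = prepend c (fromWord w)

fromWord-Records : (w : Vec AB m) → Records (fromWord w) w
fromWord-Records []      = records λ _ ()
fromWord-Records (c ∷ w) = Records-prepend c (fromWord w) (fromWord-Records w)

lookup-∷ʳ-last : (xs : Vec A n) {x : A} → lookup (xs ∷ʳ x) (fromℕ n) ≡ x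
lookup-∷ʳ-last []       = refl
lookup-∷ʳ-last (_ ∷ xs) = lookup-∷ʳ-last xs

lookup-∷ʳ-inject₁ : (xs : Vec A n) {x : A} (i : Fin n) → lookup (xs ∷ʳ x) (inject₁ i) ≡ lookup xs i
lookup-∷ʳ-inject₁ (_ ∷ _)  zero    = refl
lookup-∷ʳ-inject₁ (_ ∷ xs) (suc i) = lookup-∷ʳ-inject₁ xs i

lookup-reverse-opposite : (xs : Vec A n) (i : Fin n) → lookup (reverse xs) (opposite i) ≡ lookup xs i
lookup-reverse-opposite (x ∷ xs) zero =
  trans (cong (λ v → lookup v (fromℕ _)) (reverse-∷ x xs)) (lookup-∷ʳ-last (reverse xs))
lookup-reverse-opposite (x ∷ xs) (suc i) = begin
  lookup (reverse (x ∷ xs)) (inject₁ (opposite i))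
    ≡⟨ cong (λ v → lookup v (inject₁ (opposite i))) (reverse-∷ x xs) ⟩
  lookup (reverse xs ∷ʳ x) (inject₁ (opposite i))
    ≡⟨ lookup-∷ʳ-inject₁ (reverse xs) (opposite i) ⟩
  lookup (reverse xs) (opposite i)
    ≡⟨ lookup-reverse-opposite xs i ⟩
  lookup xs i
    ∎
  where open ≡-Reasoning

lookup-reverse : (xs : Vec A n) (i : Fin n) → lookup (reverse xs) i ≡ lookup xs (opposite i)
lookup-reverse xs i = trans (cong (lookup (reverse xs)) (sym (opposite-involutive i)))
                            (lookup-reverse-opposite xs (opposite i))

opposite-< : {i j : Fin n} → i < j → opposite j < opposite i
opposite-< {i = i} {j} i<j = subst₂ _<ℕ_ (sym (opposite-prop j)) (sym (opposite-prop i))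
  (ℕ.∸-monoʳ-< (s<s i<j) (toℕ<n j))

Subword : Vec A k → Vec A m → Set
Subword {k = k} {m = m} u w = Σ (Fin k → Fin m) λ g → Increasing g × (∀ j → lookup u j ≡ lookup w (g j))

Subword-reverse : {u : Vec A k} {w : Vec A m} → Subword u w → Subword (reverse u) (reverse w)
Subword-reverse {u = u} {w} (g , g-increasing , letters) =
  opposite ∘ g ∘ opposite , (λ i j → opposite-< ∘ g-increasing _ _ ∘ opposite-<) , letters′
  where
  letters′ : ∀ j → lookup (reverse u) j ≡ lookup (reverse w) (opposite (g (opposite j)))
  letters′ j = begin
    lookup (reverse u) j                             ≡⟨ lookup-reverse u j ⟩
    lookup u (opposite j)                            ≡⟨ letters (opposite j) ⟩
    lookup w (g (opposite j))                        ≡⟨ lookup-reverse-opposite w (g (opposite j)) ⟨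
    lookup (reverse w) (opposite (g (opposite j)))   ∎
    where open ≡-Reasoning

Subword⇔Subword-reverse : {u : Vec A k} {w : Vec A m} → Subword u w ⇔ Subword (reverse u) (reverse w)
Subword⇔Subword-reverse {u = u} {w} = mk⇔ (Subword-reverse {u = u} {w})
  (subst₂ Subword (reverse-involutive u) (reverse-involutive w) ∘ Subword-reverse {u = reverse u} {reverse w})

increasing-tail : {f : Fin (suc k) → Fin (suc m)} → Increasing f →
                  Σ (Fin k → Fin m) λ g → Increasing g × (∀ j → suc (g j) ≡ f (suc j))
increasing-tail {k} {m} {f} f-increasing = g , g-increasing , shift
  where
  nonzero : ∀ j → zero ≢ f (suc j)
  nonzero j e = ℕ.n≮0 (subst (f zero <_) (sym e) (f-increasing zero (suc j) z<s))
  g : Fin k → Fin m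
  g j = punchOut (nonzero j)
  shift : ∀ j → suc (g j) ≡ f (suc j)
  shift j = punchIn-punchOut (nonzero j)
  g-increasing : Increasing g
  g-increasing i j i<j =
    s<s⁻¹ (subst₂ _<_ (sym (shift i)) (sym (shift j)) (f-increasing (suc i) (suc j) (s<s i<j)))

≼⇒Subword : {σ : Vec (Fin (suc k)) (suc k)} {u : Vec AB k} {π : Vec (Fin (suc m)) (suc m)} {w : Vec AB m} →
            Records σ u → Records π w → σ ≼ π → Subword u w
≼⇒Subword {u = u} {w = w} rσ rπ (f , f-increasing , same-order) with increasing-tail f-increasing
... | g , g-increasing , shift = g , g-increasing , letters
  where
  letters : ∀ j → lookup u j ≡ lookup w (g j)
  letters j = Beyond-letter (lookup u j) (lookup w (g j)) (beyond rσ zero j z<s)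
    (Records⇒Beyond rπ (f-increasing zero (suc j) z<s) (sym (shift j))) (same-order zero (suc j))

Subword⇒≼ : {σ : Vec (Fin (suc k)) (suc k)} {u : Vec AB k} {π : Vec (Fin (suc m)) (suc m)} {w : Vec AB m} →
            Records σ u → Records π w → Subword u w → σ ≼ π
Subword⇒≼ rσ rπ (g , g-increasing , letters) =
  lift 1 g , lift-increasing g-increasing , Records-compare rσ rπ g-increasing letters

≼⇔Subword : {σ : Vec (Fin (suc k)) (suc k)} {u : Vec AB k} {π : Vec (Fin (suc m)) (suc m)} {w : Vec AB m} →
            Records σ u → Records π w → σ ≼ π ⇔ Subword u w
≼⇔Subword rσ rπ = mk⇔ (≼⇒Subword rσ rπ) (Subword⇒≼ rσ rπ)

ω-injective : (π π′ : Vec (Fin (suc m)) (suc m)) → InV π → InV π′ → ω π ≡ ω π′ → π ≡ π′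
ω-injective π π′ vπ vπ′ ωπ≡ωπ′ =
  Records-unique (InV⇒Records π vπ) (subst (Records π′) (sym ωπ≡ωπ′) (InV⇒Records π′ vπ′))

ω-surjective : (w : Vec AB m) → Σ (Vec (Fin (suc m)) (suc m)) λ π → InV π × ω π ≡ w
ω-surjective w = fromWord w , Records⇒InV (fromWord-Records w) , Records⇒ω (fromWord w) (fromWord-Records w)

≼-reverse-invariant : (π π′ : Vec (Fin (suc m)) (suc m)) (σ σ′ : Vec (Fin (suc k)) (suc k)) →
                      InV π → InV π′ → InV σ → InV σ′ →
                      ω π′ ≡ reverse (ω π) → ω σ′ ≡ reverse (ω σ) → (σ ≼ π) ⇔ (σ′ ≼ π′)
≼-reverse-invariant π π′ σ σ′ vπ vπ′ vσ vσ′ ωπ′≡ ωσ′≡ =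
  ⇔.trans (≼⇔Subword (InV⇒Records σ vσ) (InV⇒Records π vπ))
    (⇔.trans (Subword⇔Subword-reverse {u = ω σ} {ω π}) (⇔.sym (≼⇔Subword rσ′ rπ′)))
  where
  rπ′ : Records π′ (reverse (ω π))
  rπ′ = subst (Records π′) ωπ′≡ (InV⇒Records π′ vπ′)
  rσ′ : Records σ′ (reverse (ω σ))
  rσ′ = subst (Records σ′) ωσ′≡ (InV⇒Records σ′ vσ′)

mainTheorem10 :
    ((m : ℕ) →
      ((π π′ : Vec (Fin (suc m)) (suc m)) → InV π → InV π′ → ω π ≡ ω π′ → π ≡ π′)
      × ((w : Vec AB m) → Σ (Vec (Fin (suc m)) (suc m)) λ π → InV π × ω π ≡ w))
    × ((m k : ℕ) (π π′ : Vec (Fin (suc m)) (suc m)) (σ σ′ : Vec (Fin (suc k)) (suc k)) →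
      InV π → InV π′ → InV σ → InV σ′ →
      ω π′ ≡ reverse (ω π) → ω σ′ ≡ reverse (ω σ) →
      (σ ≼ π) ⇔ (σ′ ≼ π′))
mainTheorem10 = (λ m → ω-injective , ω-surjective) , (λ m k → ≼-reverse-invariant)
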